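{- Let $T=(T,S,\epsilon F)$ be a BY forest and let $T_0=(T_0,S,\epsilon F)$ be the convex hull of $S$ in $T$ (the union of $S$ with all paths in $T$ joining two points of $S$), with the induced structure of a BY forest. Then $\bar\Phi_T\cong\bar\Phi_{T_0}$ equivariantly for the $\epsilon F$-action; in particular $\Phi_T\cong\Phi_{T_0}$ and $c_T=c_{T_0}$. Moreover, if $T$ satisfies parity condition (A) (resp. (B)), then so does $T_0$.
   Context: A BY forest is a triple $T=(T,S,\epsilon F)$ where $T$ is a finite graph-theoretic forest with an edge-length function $l:E(T)\to\{1,2,3,\dots\}$ (distances are sums of edge lengths), $S\subseteq T$ is a subgraph, $F$ is a length-preserving graph automorphism of $T$ with $F(S)=S$, and $\epsilon:\pi_0(T\setminus S)\to\{\pm1\}$ is a function on the connected components of the topological complement $T\setminus S$. Let $\Lambda_T=H_1(T,S;\mathbb Z)$, viewed inside the free abelian group on oriented edges not in $S$, with intersection length pairing the restriction of $\langle e,e'\rangle=l(e)\delta_{e,e'}$; the signed automorphism acts by sending the class of a path $\gamma$ in the closure of a component $C$ of $T\setminus S$ to $\epsilon(C)[F\gamma]$. Then $\bar\Phi_T=\Lambda_T^\vee/\Lambda_T$ (with $\Lambda_T^\vee=\mathrm{Hom}(\Lambda_T,\mathbb Z)$, $\Lambda_T\hookrightarrow\Lambda_T^\vee$ induced by the pairing) with induced $\epsilon F$-action, $\Phi_T=\bar\Phi_T^{\epsilon F}$ and $c_T=\#\Phi_T$. Parity condition (A): if two vertices of $T$ lie an odd distance apart, then at least one is either (i) a leaf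 in $S$ whose incident edge is not in $S$, (ii) of degree $2$ and not in $S$, or (iii) of degree $2$ and in the interior of $S$. Parity condition (B): no iterate of $F$ inverts (maps to itself with endpoints swapped) any edge of odd length. -}

module Defs where

open import Data.Nat using (ℕ; zero; suc; _≤_)
open import Data.Nat as ℕ using ()
open import Data.Bool using (Bool; true; false; if_then_else_)
open import Data.Fin using (Fin; zero; suc; _≟_)
open import Data.Fin.Permutation using (Permutation′; _⟨$⟩ʳ_; _⟨$⟩ˡ_)
open import Data.Integer using (ℤ; +_; _+_; _*_; _-_; 0ℤ; 1ℤ; -1ℤ)
open import Data.List using (List; []; _∷_)
open import Data.List.Membership.Propositional using (_∈_)
open import Data.List.Relation.Unary.All using (All)
open import Data.List.Relation.Unary.Unique.Propositional using (Unique)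
open import Data.Product using (Σ; ∃; ∃-syntax; _×_; _,_)
open import Data.Sum using (_⊎_)
open import Data.Unit using (⊤)
open import Relation.Nullary using (¬_)
open import Relation.Nullary.Decidable using (⌊_⌋)
open import Relation.Binary.PropositionalEquality using (_≡_; _≢_)
open import Function using (_∘_; _⇔_)

ΣF : ∀ {k} → (Fin k → ℤ) → ℤ
ΣF {zero}  f = 0ℤ
ΣF {suc k} f = f zero + ΣF (f ∘ suc)

iter : ∀ {A : Set} → ℕ → (A → A) → A → A
iter zero    g x = x
iter (suc k) g x = g (iter k g x)

Odd : ℕ → Set
Odd k = ℕ._%_ k 2 ≡ 1

module Walks {n m : ℕ} (src tgt : Fin m → Fin n) (len : Fin m → ℕ) where

  Step : Fin n → Fin n → Fin m → Set
  Step u w e = (src e ≡ u × tgt e ≡ w) ⊎ (src e ≡ w × tgt e ≡ u)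

  infixr 5 _∷⟨_⟩_
  data Path : Fin n → Fin n → Set where
    []     : ∀ {v} → Path v v
    _∷⟨_⟩_ : ∀ {u w v} (e : Fin m) → Step u w e → Path w v → Path u v

  edges : ∀ {u v} → Path u v → List (Fin m)
  edges []             = []
  edges (e ∷⟨ _ ⟩ p)   = e ∷ edges p

  verts : ∀ {u v} → Path u v → List (Fin n)
  verts {u} []           = u ∷ []
  verts {u} (e ∷⟨ _ ⟩ p) = u ∷ verts p

  vertsInit : ∀ {u v} → Path u v → List (Fin n)
  vertsInit []             = []
  vertsInit {u} (e ∷⟨ _ ⟩ p) = u ∷ vertsInit p

  pathLen : ∀ {u v} → Path u v → ℕ
  pathLen []           = 0
  pathLen (e ∷⟨ _ ⟩ p) = len e ℕ.+ pathLen p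

  Simple : ∀ {u v} → Path u v → Set
  Simple p = Unique (verts p)

  IsForest : Set
  IsForest = ∀ v (p : Path v v) → Unique (edges p) → Unique (vertsInit p) → edges p ≡ []

record BYForest : Set where
  field
    n m     : ℕ
    src tgt : Fin m → Fin n
    len     : Fin m → ℕ
    len-pos : ∀ e → 1 ≤ len e
    forest  : Walks.IsForest src tgt len
    SV      : Fin n → Bool
    SE      : Fin m → Bool
    S-sub   : ∀ e → SE e ≡ true → SV (src e) ≡ true × SV (tgt e) ≡ true
    Fv      : Permutation′ n
    Fe      : Permutation′ m
    F-hom   : ∀ e → (src (Fe ⟨$⟩ʳ e) ≡ Fv ⟨$⟩ʳ src e × tgt (Fe ⟨$⟩ʳ e) ≡ Fv ⟨$⟩ʳ tgt e)
                  ⊎ (src (Fe ⟨$⟩ʳ e) ≡ Fv ⟨$⟩ʳ tgt e × tgt (Fe ⟨$⟩ʳ e) ≡ Fv ⟨$⟩ʳ src e)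
    F-len   : ∀ e → len (Fe ⟨$⟩ʳ e) ≡ len e
    F-SV    : ∀ v → SV (Fv ⟨$⟩ʳ v) ≡ SV v
    F-SE    : ∀ e → SE (Fe ⟨$⟩ʳ e) ≡ SE e
    -- ε, recorded on the edges not in S (true = +1, false = -1);
    -- it must be constant on each connected component of T \ S, i.e.
    -- agree on two non-S edges meeting at a non-S vertex.
    ε       : Fin m → Bool
    ε-const : ∀ e e' v → SE e ≡ false → SE e' ≡ false → SV v ≡ false →
              (src e ≡ v ⊎ tgt e ≡ v) → (src e' ≡ v ⊎ tgt e' ≡ v) → ε e ≡ ε e'

-- A subgraph K of the underlying forest, carrying the induced BY structure
-- (used for T itself, K = everything, and for the convex hull T₀).
record Sub (T : BYForest) : Set₁ where
  open BYForest T
  field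
    KV : Fin n → Set
    KE : Fin m → Set

module _ (T : BYForest) where
  open BYForest T
  open Walks src tgt len

  full : Sub T
  full = record { KV = λ _ → ⊤ ; KE = λ _ → ⊤ }

  hull : Sub T
  hull = record
    { KV = λ v → SV v ≡ true ⊎
             (∃[ a ] ∃[ b ] Σ (Path a b) λ p → Simple p × SV a ≡ true × SV b ≡ true × v ∈ verts p)
    ; KE = λ e → SE e ≡ true ⊎
             (∃[ a ] ∃[ b ] Σ (Path a b) λ p → Simple p × SV a ≡ true × SV b ≡ true × e ∈ edges p)
    }

module _ (T : BYForest) (K : Sub T) where
  open BYForest T
  open Sub K
  open Walks src tgt len

  sgn : Bool → ℤ
  sgn true  = 1ℤ
  sgn false = -1ℤ

  orient : Fin m → ℤ
  orient e = if ⌊ src (Fe ⟨$⟩ʳ e) ≟ Fv ⟨$⟩ʳ src e ⌋ then 1ℤ else -1ℤ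

  ind : Fin n → Fin n → ℤ
  ind a b = if ⌊ a ≟ b ⌋ then 1ℤ else 0ℤ

  -- integral 1-chains (coefficient of each edge, oriented src e → tgt e)
  Chain : Set
  Chain = Fin m → ℤ

  _+ᶜ_ : Chain → Chain → Chain
  (c +ᶜ d) e = c e + d e

  ∂ : Chain → Fin n → ℤ
  ∂ c v = ΣF λ e → c e * (ind (tgt e) v - ind (src e) v)

  -- Λ = H₁(K, S; ℤ) inside the free abelian group on edges of K not in S
  IsCycle : Chain → Set
  IsCycle c = (∀ e → ¬ (KE e × SE e ≡ false) → c e ≡ 0ℤ)
            × (∀ v → KV v → SV v ≡ false → ∂ c v ≡ 0ℤ)

  ⟪_,_⟫ : Chain → Chain → ℤ
  ⟪ c , d ⟫ = ΣF λ e → (+ len e) * (c e * d e)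

  -- inverse of the signed automorphism εF on chains:
  -- (εF) sends edge e to ε(e)·orient(e)·(F e)
  σ⁻¹ : Chain → Chain
  σ⁻¹ c e = sgn (ε e) * (orient e * c (Fe ⟨$⟩ʳ e))

  -- Λ^∨ = Hom(Λ, ℤ): a function on chains, used only on cycles,
  -- additive on cycles and respecting equality of cycles
  record Dual : Set where
    field
      fn   : Chain → ℤ
      add  : ∀ c d → IsCycle c → IsCycle d → fn (c +ᶜ d) ≡ fn c + fn d
      ext  : ∀ c d → IsCycle c → (∀ e → c e ≡ d e) → fn c ≡ fn d
  open Dual public

  -- equality in Φ̄ = Λ^∨ / Λ
  _≈Φ_ : Dual → Dual → Set
  f ≈Φ g = ∃[ a ] IsCycle a × (∀ x → IsCycle x → fn f x ≡ fn g x + ⟪ a , x ⟫)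

  IsSumΦ : Dual → Dual → Dual → Set
  IsSumΦ f g h = ∃[ a ] IsCycle a × (∀ x → IsCycle x → fn h x ≡ (fn f x + fn g x) + ⟪ a , x ⟫)

  -- g = (εF)·f in Φ̄, for the induced action (εF·f)(x) = f((εF)⁻¹ x)
  IsActΦ : Dual → Dual → Set
  IsActΦ f g = ∃[ a ] IsCycle a × (∀ x → IsCycle x → fn g x ≡ fn f (σ⁻¹ x) + ⟪ a , x ⟫)

  -- elements of Φ = Φ̄^{εF}
  FixedΦ : Dual → Set
  FixedΦ f = IsActΦ f f

  -- c_T = k : Φ has exactly k elements
  CardΦ : ℕ → Set
  CardΦ k = Σ (Fin k → Dual) λ g → (∀ i → FixedΦ (g i)) × (∀ i j → g i ≈Φ g j → i ≡ j)
            × (∀ f → FixedΦ f → ∃[ i ] f ≈Φ g i)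

  Inc : Fin n → Fin m → Set
  Inc v e = KE e × (src e ≡ v ⊎ tgt e ≡ v)

  LeafEdgeNotS : Fin n → Set
  LeafEdgeNotS v = ∃[ e ] Inc v e × SE e ≡ false × (∀ e' → Inc v e' → e' ≡ e)

  Deg2 : Fin n → Set
  Deg2 v = ∃[ e₁ ] ∃[ e₂ ] e₁ ≢ e₂ × Inc v e₁ × Inc v e₂ × (∀ e' → Inc v e' → e' ≡ e₁ ⊎ e' ≡ e₂)

  InteriorS : Fin n → Set
  InteriorS v = SV v ≡ true × (∀ e → Inc v e → SE e ≡ true)

  Special : Fin n → Set
  Special v = (SV v ≡ true × LeafEdgeNotS v)
            ⊎ (Deg2 v × SV v ≡ false)
            ⊎ (Deg2 v × InteriorS v)

  OddApart : Fin n → Fin n → Set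
  OddApart u v = Σ (Path u v) λ p → Simple p × All KE (edges p) × Odd (pathLen p)

  ParityA : Set
  ParityA = ∀ u v → KV u → KV v → OddApart u v → Special u ⊎ Special v

  ParityB : Set
  ParityB = ∀ k e → KE e → Odd (len e) →
            ¬ (iter k (Fe ⟨$⟩ʳ_) e ≡ e × iter k (Fv ⟨$⟩ʳ_) (src e) ≡ tgt e)

EquivIso : (T : BYForest) → Sub T → Sub T → Set
EquivIso T K K' = Σ (Dual T K → Dual T K') λ φ →
    (∀ f g → _≈Φ_ T K f g → _≈Φ_ T K' (φ f) (φ g))
  × (∀ f g → _≈Φ_ T K' (φ f) (φ g) → _≈Φ_ T K f g)
  × (∀ h → ∃[ f ] _≈Φ_ T K' (φ f) h)
  × (∀ f g h → IsSumΦ T K f g h → IsSumΦ T K' (φ f) (φ g) (φ h))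
  × (∀ f g → IsActΦ T K f g → IsActΦ T K' (φ f) (φ g))

module Submission where

-- The lattice Λ = H₁(T, S) and hence everything built from it (Φ̄, the εF-action, Φ, c_T) only
-- depends on which chains are relative cycles, so it suffices to show that T and its convex hull
-- T₀ of S have the same relative cycles. A hull cycle is a cycle of T because a vertex carrying a
-- non-zero boundary term lies on an edge of the support, hence in T₀. Conversely, starting from
-- an edge of the support of a relative cycle of T one can keep walking along the support as long
-- as the current vertex is not in S, since the boundary vanishes there; in a finite forest the
-- walk never revisits a vertex, so it stops in S. Walking in both directions puts the edge on a
-- simple path between two points of S, i.e. in T₀. The parity conditions only get weaker on T₀:
-- a special vertex of T that lies in T₀ keeps all its edges in T₀.

open import Defs
open import Data.Bool using (true; false)
import Data.Bool.Properties as Boolₚ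
open import Data.Empty using (⊥; ⊥-elim)
open import Data.Fin using (Fin; zero; suc; _≟_)
import Data.Fin as Fin
import Data.Fin.Properties as Finₚ
open import Data.Integer using (ℤ; +_; _+_; _*_; 0ℤ)
import Data.Integer as ℤ
import Data.Integer.Properties as ℤₚ
open import Data.List using (List; []; _∷_; _++_; _∷ʳ_; length)
import Data.List as List
open import Data.List.Membership.Propositional using (_∈_; _∉_)
open import Data.List.Membership.Propositional.Properties using (∈-lookup)
import Data.List.Membership.DecPropositional as DecMembership
open import Data.List.Relation.Binary.Permutation.Propositional
  using (_↭_; ↭-refl; ↭-sym; ↭-trans; ↭-prep; ↭-reflexive; ↭⇒↭ₛ)
open import Data.List.Relation.Binary.Permutation.Propositional.Properties
  using (All-resp-↭; ∈-resp-↭; ∷↭∷ʳ)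
import Data.List.Relation.Binary.Permutation.Setoid.Properties as Permutationₛ
open import Data.List.Relation.Unary.All using (All; []; _∷_)
import Data.List.Relation.Unary.All as All
import Data.List.Relation.Unary.All.Properties as Allₚ
open import Data.List.Relation.Unary.AllPairs using ([]; _∷_)
open import Data.List.Relation.Unary.Any using (here; there)
import Data.List.Relation.Unary.Any.Properties as Anyₚ
open import Data.List.Relation.Unary.Unique.Propositional using (Unique)
open import Data.Nat using (zero; suc; _≤_; _<_; s≤s)
import Data.Nat as ℕ
import Data.Nat.Properties as ℕₚ
open import Data.Product using (∃-syntax; Σ; _×_; _,_; proj₁; proj₂)
open import Data.Sum using (_⊎_; inj₁; inj₂)
import Data.Sum as Sum
open import Data.Unit using (⊤; tt)
open import Function using (_∘_; _⇔_; mk⇔; Equivalence)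
import Function.Properties.Equivalence as ⇔
open import Relation.Binary.PropositionalEquality
  using (_≡_; _≢_; refl; sym; trans; cong; cong₂; subst; setoid)
open import Relation.Nullary using (¬_; yes; no)
open import Relation.Nullary.Decidable using (decidable-stable)

module _ {a} {A : Set a} where

  Unique-∷⁺ : ∀ {x : A} {xs} → x ∉ xs → Unique xs → Unique (x ∷ xs)
  Unique-∷⁺ x∉ u = Allₚ.¬Any⇒All¬ _ x∉ ∷ u

  Unique-++⁻ˡ : ∀ xs {ys : List A} → Unique (xs ++ ys) → Unique xs
  Unique-++⁻ˡ []       _        = []
  Unique-++⁻ˡ (x ∷ xs) (x∉ ∷ u) = Allₚ.++⁻ˡ xs x∉ ∷ Unique-++⁻ˡ xs u

  Unique-++⇒disjoint : ∀ xs {ys : List A} {z} → Unique (xs ++ ys) → z ∈ xs → z ∉ ys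
  Unique-++⇒disjoint (x ∷ xs) (x∉ ∷ _) (here refl)  = λ x∈ → All.lookup (Allₚ.++⁻ʳ xs x∉) x∈ refl
  Unique-++⇒disjoint (x ∷ xs) (_ ∷ u)  (there z∈xs) = Unique-++⇒disjoint xs u z∈xs

  Unique-resp-↭ : ∀ {xs ys : List A} → xs ↭ ys → Unique xs → Unique ys
  Unique-resp-↭ p = Permutationₛ.Unique-resp-↭ (setoid A) (↭⇒↭ₛ p)

  Unique⇒lookup-injective : ∀ {xs : List A} → Unique xs →
                            ∀ {i j} → i Fin.< j → List.lookup xs i ≢ List.lookup xs j
  Unique⇒lookup-injective {_ ∷ _} (x∉ ∷ _) {zero}  {suc j} _         = All.lookup x∉ (∈-lookup j)
  Unique⇒lookup-injective {_ ∷ _} (_ ∷ u)  {suc i} {suc j} (s≤s i<j) = Unique⇒lookup-injective u i<j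

Unique⇒length≤ : ∀ {n} {xs : List (Fin n)} → Unique xs → length xs ≤ n
Unique⇒length≤ {n} {xs} u = ℕₚ.≮⇒≥ λ n<length →
  let i , j , i<j , same = Finₚ.pigeonhole n<length (List.lookup xs)
  in Unique⇒lookup-injective u i<j same

ΣF-zeros : ∀ {k} (f : Fin k → ℤ) → (∀ i → f i ≡ 0ℤ) → ΣF f ≡ 0ℤ
ΣF-zeros {zero}  f f≡0 = refl
ΣF-zeros {suc k} f f≡0 = cong₂ _+_ (f≡0 zero) (ΣF-zeros (λ i → f (suc i)) (λ i → f≡0 (suc i)))

ΣF≢0⇒∃≢0 : ∀ {k} (f : Fin k → ℤ) → ΣF f ≢ 0ℤ → ∃[ i ] f i ≢ 0ℤ
ΣF≢0⇒∃≢0 {zero}  f Σ≢0 = ⊥-elim (Σ≢0 refl)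
ΣF≢0⇒∃≢0 {suc k} f Σ≢0 with f zero ℤ.≟ 0ℤ
... | no  f₀≢0 = zero , f₀≢0
... | yes f₀≡0 =
  let i , fᵢ≢0 = ΣF≢0⇒∃≢0 (λ i → f (suc i)) (λ rest≡0 → Σ≢0 (cong₂ _+_ f₀≡0 rest≡0))
  in suc i , fᵢ≢0

ΣF≡0⇒another≢0 : ∀ {k} (f : Fin k → ℤ) → ΣF f ≡ 0ℤ →
                 ∀ i → f i ≢ 0ℤ → ∃[ j ] j ≢ i × f j ≢ 0ℤ
ΣF≡0⇒another≢0 {suc k} f Σ≡0 zero f₀≢0 =
  let j , fⱼ≢0 = ΣF≢0⇒∃≢0 (λ i → f (suc i)) λ rest≡0 →
                   f₀≢0 (trans (sym (ℤₚ.+-identityʳ (f zero))) (trans (cong (λ t → f zero + t) (sym rest≡0)) Σ≡0))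
  in suc j , (λ ()) , fⱼ≢0
ΣF≡0⇒another≢0 {suc k} f Σ≡0 (suc i) fᵢ≢0 with f zero ℤ.≟ 0ℤ
... | no  f₀≢0 = zero , (λ ()) , f₀≢0
... | yes f₀≡0 =
  let j , j≢i , fⱼ≢0 = ΣF≡0⇒another≢0 (λ i → f (suc i))
                         (trans (sym (ℤₚ.+-identityˡ _)) (trans (cong (λ t → t + ΣF (λ i → f (suc i))) (sym f₀≡0)) Σ≡0)) i fᵢ≢0
  in suc j , j≢i ∘ Finₚ.suc-injective , fⱼ≢0

*-≢0 : ∀ {i j : ℤ} → i ≢ 0ℤ → j ≢ 0ℤ → i * j ≢ 0ℤ
*-≢0 {i} i≢0 j≢0 ij≡0 = Sum.[ i≢0 , j≢0 ] (ℤₚ.i*j≡0⇒i≡0∨j≡0 i ij≡0)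

*-≢0⇒ˡ≢0 : ∀ {i j : ℤ} → i * j ≢ 0ℤ → i ≢ 0ℤ
*-≢0⇒ˡ≢0 {j = j} ij≢0 refl = ij≢0 (ℤₚ.*-zeroˡ j)

*-≢0⇒ʳ≢0 : ∀ {i j : ℤ} → i * j ≢ 0ℤ → j ≢ 0ℤ
*-≢0⇒ʳ≢0 {i} ij≢0 refl = ij≢0 (ℤₚ.*-zeroʳ i)

module _ (T : BYForest) (K : Sub T) where
  open BYForest T

  zero-IsCycle : IsCycle T K (λ _ → 0ℤ)
  zero-IsCycle = (λ _ _ → refl) , λ v _ _ →
    ΣF-zeros _ λ e → ℤₚ.*-zeroˡ (ind T K (tgt e) v ℤ.- ind T K (src e) v)

  ≈Φ-refl : ∀ f → _≈Φ_ T K f f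
  ≈Φ-refl f = (λ _ → 0ℤ) , zero-IsCycle , λ x _ →
    sym (trans (cong (λ t → Dual.fn f x + t) (⟪0,x⟫≡0 x)) (ℤₚ.+-identityʳ _))
    where
    ⟪0,x⟫≡0 : ∀ x → ⟪_,_⟫ T K (λ _ → 0ℤ) x ≡ 0ℤ
    ⟪0,x⟫≡0 x = ΣF-zeros _ λ e → trans (cong (λ t → + len e * t) (ℤₚ.*-zeroˡ (x e))) (ℤₚ.*-zeroʳ (+ len e))

  -- ≈Φ, IsSumΦ and IsActΦ all unfold to this shape, with Q independent of K.
  CycleWitnessed : (Chain T K → Chain T K → Set) → Set
  CycleWitnessed Q = ∃[ a ] IsCycle T K a × (∀ x → IsCycle T K x → Q a x)

module Transport (T : BYForest) {K K' : Sub T}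
                 (cycles⇔ : ∀ c → IsCycle T K c ⇔ IsCycle T K' c) where
  open Equivalence

  transportDual : Dual T K → Dual T K'
  transportDual d = record
    { fn  = Dual.fn d
    ; add = λ x y cx cy → Dual.add d x y (from (cycles⇔ x) cx) (from (cycles⇔ y) cy)
    ; ext = λ x y cx → Dual.ext d x y (from (cycles⇔ x) cx)
    }

  transportWitnessed : ∀ {Q} → CycleWitnessed T K Q → CycleWitnessed T K' Q
  transportWitnessed (a , cycle-a , Q-a) =
    a , to (cycles⇔ a) cycle-a , λ x cx → Q-a x (from (cycles⇔ x) cx)

module _ (T : BYForest) {K K' : Sub T} (cycles⇔ : ∀ c → IsCycle T K c ⇔ IsCycle T K' c) where
  open Transport T cycles⇔
  open Transport T (λ c → ⇔.sym (cycles⇔ c))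
    renaming (transportDual to transportDual⁻¹; transportWitnessed to transportWitnessed⁻¹)

  sameCycles⇒EquivIso : EquivIso T K K'
  sameCycles⇒EquivIso =
      transportDual
    , (λ _ _ → transportWitnessed)
    , (λ _ _ → transportWitnessed⁻¹)
    , (λ h → transportDual⁻¹ h , ≈Φ-refl T K' h)
    , (λ _ _ _ → transportWitnessed)
    , (λ _ _ → transportWitnessed)

  sameCycles⇒CardΦ⇔ : ∀ k → CardΦ T K k ⇔ CardΦ T K' k
  sameCycles⇒CardΦ⇔ k = mk⇔
    (λ (g , fixed , injective , onto) →
         (λ i → transportDual (g i)) , (λ i → transportWitnessed (fixed i))
       , (λ i j gᵢ≈gⱼ → injective i j (transportWitnessed⁻¹ gᵢ≈gⱼ))
       , λ f f-fixed → let i , f≈gᵢ = onto (transportDual⁻¹ f) (transportWitnessed⁻¹ f-fixed)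
                       in i , transportWitnessed f≈gᵢ)
    (λ (g , fixed , injective , onto) →
         (λ i → transportDual⁻¹ (g i)) , (λ i → transportWitnessed⁻¹ (fixed i))
       , (λ i j gᵢ≈gⱼ → injective i j (transportWitnessed gᵢ≈gⱼ))
       , λ f f-fixed → let i , f≈gᵢ = onto (transportDual f) (transportWitnessed f-fixed)
                       in i , transportWitnessed⁻¹ f≈gᵢ)

module ForestPaths (T : BYForest) where
  open BYForest T
  open Walks src tgt len

  Incident : Fin n → Fin m → Set
  Incident v e = src e ≡ v ⊎ tgt e ≡ v

  Step-sym : ∀ {u w e} → Step u w e → Step w u e
  Step-sym = Sum.swap

  Step⇒incidentˡ : ∀ {u w e} → Step u w e → Incident u e
  Step⇒incidentˡ (inj₁ (s , _)) = inj₁ s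
  Step⇒incidentˡ (inj₂ (_ , t)) = inj₂ t

  Step⇒incidentʳ : ∀ {u w e} → Step u w e → Incident w e
  Step⇒incidentʳ = Step⇒incidentˡ ∘ Step-sym

  Incident⇒Step : ∀ {w e} → Incident w e → ∃[ u ] Step u w e
  Incident⇒Step {e = e} (inj₁ s) = tgt e , inj₂ (s , refl)
  Incident⇒Step {e = e} (inj₂ t) = src e , inj₁ (refl , t)

  start∈verts : ∀ {x y} (p : Path x y) → x ∈ verts p
  start∈verts []          = here refl
  start∈verts (_ ∷⟨ _ ⟩ _) = here refl

  incident∈verts : ∀ {x y g z} (p : Path x y) → g ∈ edges p → Incident z g → z ∈ verts p
  incident∈verts (_ ∷⟨ inj₁ (refl , refl) ⟩ p) (here refl) (inj₁ refl) = here refl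
  incident∈verts (_ ∷⟨ inj₁ (refl , refl) ⟩ p) (here refl) (inj₂ refl) = there (start∈verts p)
  incident∈verts (_ ∷⟨ inj₂ (refl , refl) ⟩ p) (here refl) (inj₁ refl) = there (start∈verts p)
  incident∈verts (_ ∷⟨ inj₂ (refl , refl) ⟩ p) (here refl) (inj₂ refl) = here refl
  incident∈verts (_ ∷⟨ _ ⟩ p)                  (there g∈)  z-g         = there (incident∈verts p g∈ z-g)

  Simple⇒Unique-edges : ∀ {x y} (p : Path x y) → Simple p → Unique (edges p)
  Simple⇒Unique-edges []           _        = []
  Simple⇒Unique-edges (e ∷⟨ s ⟩ p) (x∉ ∷ u) =
    Unique-∷⁺ (λ e∈ → All.lookup x∉ (incident∈verts p e∈ (Step⇒incidentˡ s)) refl)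
              (Simple⇒Unique-edges p u)

  infixr 5 _++ₚ_
  _++ₚ_ : ∀ {x y z} → Path x y → Path y z → Path x z
  []           ++ₚ q = q
  (e ∷⟨ s ⟩ p) ++ₚ q = e ∷⟨ s ⟩ (p ++ₚ q)

  edges-++ₚ : ∀ {x y z} (p : Path x y) (q : Path y z) → edges (p ++ₚ q) ≡ edges p ++ edges q
  edges-++ₚ []           q = refl
  edges-++ₚ (e ∷⟨ _ ⟩ p) q = cong (e ∷_) (edges-++ₚ p q)

  verts-++ₚ : ∀ {x y z} (p : Path x y) (q : Path y z) → verts (p ++ₚ q) ≡ vertsInit p ++ verts q
  verts-++ₚ          []           q = refl
  verts-++ₚ {x = x} (_ ∷⟨ _ ⟩ p) q = cong (x ∷_) (verts-++ₚ p q)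

  splitAt : ∀ {x y u} (p : Path x y) → u ∈ verts p →
            Σ (Path x u) λ p₁ → Σ (Path u y) λ p₂ → p ≡ p₁ ++ₚ p₂
  splitAt []           (here refl) = [] , [] , refl
  splitAt (e ∷⟨ s ⟩ p) (here refl) = [] , e ∷⟨ s ⟩ p , refl
  splitAt (e ∷⟨ s ⟩ p) (there u∈) =
    let p₁ , p₂ , p≡ = splitAt p u∈ in e ∷⟨ s ⟩ p₁ , p₂ , cong (e ∷⟨ s ⟩_) p≡

  reverseₚ : ∀ {x y} → Path x y → Path y x
  reverseₚ []           = []
  reverseₚ (e ∷⟨ s ⟩ p) = reverseₚ p ++ₚ (e ∷⟨ Step-sym s ⟩ [])

  verts-++ₚ-step : ∀ {x y z e} (p : Path x y) (s : Step y z e) → verts (p ++ₚ (e ∷⟨ s ⟩ [])) ≡ verts p ∷ʳ z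
  verts-++ₚ-step          []           s = refl
  verts-++ₚ-step {x = x} (_ ∷⟨ _ ⟩ p) s = cong (x ∷_) (verts-++ₚ-step p s)

  edges-reverseₚ : ∀ {x y} (p : Path x y) → edges (reverseₚ p) ↭ edges p
  edges-reverseₚ []           = ↭-refl
  edges-reverseₚ (e ∷⟨ s ⟩ p) =
    ↭-trans (↭-reflexive (edges-++ₚ (reverseₚ p) (e ∷⟨ Step-sym s ⟩ [])))
      (↭-trans (↭-sym (∷↭∷ʳ e _)) (↭-prep e (edges-reverseₚ p)))

  verts-reverseₚ : ∀ {x y} (p : Path x y) → verts (reverseₚ p) ↭ verts p
  verts-reverseₚ           []           = ↭-refl
  verts-reverseₚ {x = x} (e ∷⟨ s ⟩ p) =
    ↭-trans (↭-reflexive (verts-++ₚ-step (reverseₚ p) (Step-sym s)))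
      (↭-trans (↭-sym (∷↭∷ʳ x _)) (↭-prep x (verts-reverseₚ p)))

  last-edge : ∀ {x w y f} (s : Step x w f) (p : Path w y) → ∃[ g ] g ∈ edges (f ∷⟨ s ⟩ p) × Incident y g
  last-edge s []           = _ , here refl , Step⇒incidentʳ s
  last-edge s (g ∷⟨ t ⟩ p) = let h , h∈ , y-h = last-edge t p in h , there h∈ , y-h

  closing-step-not-simple : ∀ {u w y e} → Step u w e → (q₁ : Path w u) (q₂ : Path u y) →
                            Simple (q₁ ++ₚ q₂) → e ∉ edges (q₁ ++ₚ q₂) → ⊥
  closing-step-not-simple {u} {e = e} s q₁ q₂ simple e∉q with forest u (e ∷⟨ s ⟩ q₁) unique-edges unique-verts
    where
    edges-q : Unique (edges q₁ ++ edges q₂)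
    edges-q = subst Unique (edges-++ₚ q₁ q₂) (Simple⇒Unique-edges _ simple)
    verts-q : Unique (vertsInit q₁ ++ verts q₂)
    verts-q = subst Unique (verts-++ₚ q₁ q₂) simple
    unique-edges : Unique (e ∷ edges q₁)
    unique-edges = Unique-∷⁺ (λ e∈ → e∉q (subst (e ∈_) (sym (edges-++ₚ q₁ q₂)) (Anyₚ.++⁺ˡ e∈)))
                             (Unique-++⁻ˡ (edges q₁) edges-q)
    unique-verts : Unique (u ∷ vertsInit q₁)
    unique-verts = Unique-∷⁺ (λ u∈ → Unique-++⇒disjoint (vertsInit q₁) verts-q u∈ (start∈verts q₂))
                             (Unique-++⁻ˡ (vertsInit q₁) verts-q)
  ... | ()

  step-off-path : ∀ {u w y e} → Step u w e → (q : Path w y) → Simple q → e ∉ edges q → u ∉ verts q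
  step-off-path s q simple e∉q u∈q with splitAt q u∈q
  ... | q₁ , q₂ , refl = closing-step-not-simple s q₁ q₂ simple e∉q

  src≢tgt : ∀ e → src e ≢ tgt e
  src≢tgt e s≡t = step-off-path (inj₁ (refl , refl)) [] ([] ∷ []) (λ ()) (here s≡t)

  incidence : Fin m → Fin n → ℤ
  incidence e v = ind T (full T) (tgt e) v ℤ.- ind T (full T) (src e) v

  incidence≢0⇒Incident : ∀ e v → incidence e v ≢ 0ℤ → Incident v e
  incidence≢0⇒Incident e v nz with src e ≟ v | tgt e ≟ v
  ... | yes s≡v | _       = inj₁ s≡v
  ... | no  _   | yes t≡v = inj₂ t≡v
  ... | no  _   | no  _   = ⊥-elim (nz refl)

  Incident⇒incidence≢0 : ∀ e v → Incident v e → incidence e v ≢ 0ℤ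
  Incident⇒incidence≢0 e v v-e with src e ≟ v | tgt e ≟ v
  ... | yes s≡v | yes t≡v = ⊥-elim (src≢tgt e (trans s≡v (sym t≡v)))
  ... | yes _   | no  _   = λ ()
  ... | no  _   | yes _   = λ ()
  ... | no  s≢v | no  t≢v = ⊥-elim (Sum.[ s≢v , t≢v ] v-e)

  module SupportWalk (c : Fin m → ℤ)
                     (closed : ∀ v → SV v ≡ false → ΣF (λ e → c e * incidence e v) ≡ 0ℤ) where
    open DecMembership (_≟_ {n}) using (_∈?_)

    Supp : Fin m → Set
    Supp e = c e ≢ 0ℤ

    continue : ∀ {w w' f} → SV w ≡ false → Step w w' f → Supp f →
               ∃[ u ] ∃[ e ] Step u w e × e ≢ f × Supp e
    continue {w} {f = f} w∉S s f∈supp =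
      let term-f≢0 = *-≢0 f∈supp (Incident⇒incidence≢0 f w (Step⇒incidentˡ s))
          e , e≢f , term-e≢0 = ΣF≡0⇒another≢0 (λ e → c e * incidence e w) (closed w w∉S) f term-f≢0
          u , step = Incident⇒Step (incidence≢0⇒Incident e w (*-≢0⇒ʳ≢0 {c e} term-e≢0))
      in u , e , step , e≢f , *-≢0⇒ˡ≢0 {c e} term-e≢0

    -- The fuel k bounds the number of further steps: a simple path has at most n vertices.
    extendToS : ∀ k {w y g} (q : Path w y) → g ∈ edges q → n < k ℕ.+ length (verts q) →
                Simple q → All Supp (edges q) →
                ∃[ a ] Σ (Path a y) λ r → SV a ≡ true × Simple r × All Supp (edges r) × g ∈ edges r
    extendToS k {w} q@(f ∷⟨ s ⟩ p) g∈q n<k+|q| simple@(w∉p ∷ _) supp with SV w in w-S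
    ... | true  = w , q , w-S , simple , supp , g∈q
    ... | false with continue w-S s (All.head supp)
    ...   | u , e , s' , e≢f , e∈supp with u ∈? verts q | k
    ...     | yes u∈q | _    = ⊥-elim (step-off-path s' q simple e∉q u∈q)
      where
      e∉q : e ∉ edges q
      e∉q (here e≡f) = e≢f e≡f
      e∉q (there e∈p) = All.lookup w∉p (incident∈verts p e∈p (Step⇒incidentʳ s')) refl
    ...     | no  _   | zero = ⊥-elim (ℕₚ.<⇒≱ n<k+|q| (Unique⇒length≤ simple))
    ...     | no  u∉q | suc k =
      extendToS k (e ∷⟨ s' ⟩ q) (there g∈q) (subst (n <_) (sym (ℕₚ.+-suc k _)) n<k+|q|)
                (Unique-∷⁺ u∉q simple) (e∈supp ∷ supp)

    support-on-S-path : ∀ e → Supp e →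
      ∃[ a ] ∃[ b ] Σ (Path a b) λ p → Simple p × SV a ≡ true × SV b ≡ true × e ∈ edges p
    support-on-S-path e e∈supp =
      let q = e ∷⟨ inj₁ (refl , refl) ⟩ []
          a , r , a∈S , r-simple , r-supp , e∈r =
            extendToS (suc n) q (here refl) (ℕₚ.m≤m+n (suc n) _) ((src≢tgt e ∷ []) ∷ [] ∷ []) (e∈supp ∷ [])
          r⁻¹↭r = edges-reverseₚ r
          b , r' , b∈S , r'-simple , _ , e∈r' =
            extendToS (suc n) (reverseₚ r) (∈-resp-↭ (↭-sym r⁻¹↭r) e∈r) (ℕₚ.m≤m+n (suc n) _)
                      (Unique-resp-↭ (↭-sym (verts-reverseₚ r)) r-simple) (All-resp-↭ (↭-sym r⁻¹↭r) r-supp)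
      in b , a , r' , r'-simple , b∈S , a∈S , e∈r'

module _ (T : BYForest) {K : Sub T} where
  open BYForest T
  open ForestPaths T

  Deg2-restrict : ∀ {x} → (∀ e → Incident x e → Sub.KE K e) → Deg2 T (full T) x → Deg2 T K x
  Deg2-restrict incident∈K (e₁ , e₂ , e₁≢e₂ , (_ , x-e₁) , (_ , x-e₂) , only) =
    e₁ , e₂ , e₁≢e₂ , (incident∈K e₁ x-e₁ , x-e₁) , (incident∈K e₂ x-e₂ , x-e₂) ,
    λ e (_ , x-e) → only e (tt , x-e)

  Special-restrict : ∀ {x} → (∀ e → Incident x e → Sub.KE K e) → Special T (full T) x → Special T K x
  Special-restrict incident∈K (inj₁ (x∈S , e , (_ , x-e) , e∉S , only)) =
    inj₁ (x∈S , e , (incident∈K e x-e , x-e) , e∉S , λ e' (_ , x-e') → only e' (tt , x-e'))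
  Special-restrict incident∈K (inj₂ (inj₁ (deg2 , x∉S))) =
    inj₂ (inj₁ (Deg2-restrict incident∈K deg2 , x∉S))
  Special-restrict incident∈K (inj₂ (inj₂ (deg2 , x∈S , interior))) =
    inj₂ (inj₂ (Deg2-restrict incident∈K deg2 , x∈S , λ e (_ , x-e) → interior e (tt , x-e)))

module HullOfS (T : BYForest) where
  open BYForest T
  open Walks src tgt len
  open ForestPaths T

  hull-Incident⇒∈hull : ∀ {e v} → Sub.KE (hull T) e → Incident v e → Sub.KV (hull T) v
  hull-Incident⇒∈hull {e} (inj₁ e∈S) (inj₁ refl) = inj₁ (proj₁ (S-sub e e∈S))
  hull-Incident⇒∈hull {e} (inj₁ e∈S) (inj₂ refl) = inj₁ (proj₂ (S-sub e e∈S))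
  hull-Incident⇒∈hull (inj₂ (a , b , p , simple , a∈S , b∈S , e∈p)) v-e =
    inj₂ (a , b , p , simple , a∈S , b∈S , incident∈verts p e∈p v-e)

  hull-cycles⇔ : ∀ c → IsCycle T (full T) c ⇔ IsCycle T (hull T) c
  hull-cycles⇔ c = mk⇔ to from
    where
    to : IsCycle T (full T) c → IsCycle T (hull T) c
    to (outside≡0 , closed) = outside-hull≡0 , λ v _ v∉S → closed v tt v∉S
      where
      open SupportWalk c (λ v → closed v tt)
      outside-hull≡0 : ∀ e → ¬ (Sub.KE (hull T) e × SE e ≡ false) → c e ≡ 0ℤ
      outside-hull≡0 e e∉hull = decidable-stable (c e ℤ.≟ 0ℤ) λ e∈supp →
        e∈supp (outside≡0 e λ (_ , e∉S) → e∉hull (inj₂ (support-on-S-path e e∈supp) , e∉S))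

    from : IsCycle T (hull T) c → IsCycle T (full T) c
    from (outside≡0 , closed) = (λ e e∈S → outside≡0 e λ (_ , e∉S) → e∈S (tt , e∉S)) , closed-everywhere
      where
      -- A non-zero term of ∂ c at v comes from an edge e of the support; if e were in the hull
      -- minus S, then v would be in the hull and ∂ c v would vanish.
      closed-everywhere : ∀ v → ⊤ → SV v ≡ false → ∂ T (full T) c v ≡ 0ℤ
      closed-everywhere v _ v∉S = decidable-stable (∂ T (full T) c v ℤ.≟ 0ℤ) λ ∂≢0 →
        let e , term≢0 = ΣF≢0⇒∃≢0 (λ e → c e * incidence e v) ∂≢0
        in *-≢0⇒ˡ≢0 {c e} term≢0 (outside≡0 e λ (e∈hull , _) →
             ∂≢0 (closed v (hull-Incident⇒∈hull e∈hull (incidence≢0⇒Incident e v (*-≢0⇒ʳ≢0 {c e} term≢0))) v∉S))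

  S-path-interior-pair : ∀ {a b x} (q : Path a b) → Simple q → SV a ≡ true → SV b ≡ true →
    SV x ≡ false → x ∈ verts q →
    ∃[ g₁ ] ∃[ g₂ ] g₁ ≢ g₂ × g₁ ∈ edges q × g₂ ∈ edges q × Incident x g₁ × Incident x g₂
  S-path-interior-pair q simple a∈S b∈S x∉S x∈q with splitAt q x∈q
  ... | [] , _ , refl = ⊥-elim (Boolₚ.not-¬ a∈S x∉S)
  ... | _ ∷⟨ _ ⟩ _ , [] , refl = ⊥-elim (Boolₚ.not-¬ b∈S x∉S)
  ... | q₁@(_ ∷⟨ s ⟩ r) , q₂@(g₂ ∷⟨ t ⟩ _) , refl =
    let g₁ , g₁∈q₁ , x-g₁ = last-edge s r
        edges-q≡ = edges-++ₚ q₁ q₂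
        edges-q = subst Unique edges-q≡ (Simple⇒Unique-edges (q₁ ++ₚ q₂) simple)
    in g₁ , g₂ , (λ g₁≡g₂ → Unique-++⇒disjoint (edges q₁) edges-q g₁∈q₁ (here g₁≡g₂))
     , subst (g₁ ∈_) (sym edges-q≡) (Anyₚ.++⁺ˡ g₁∈q₁)
     , subst (g₂ ∈_) (sym edges-q≡) (Anyₚ.++⁺ʳ (edges q₁) (here refl))
     , x-g₁ , Step⇒incidentˡ t

  Deg2⇒incident-pair : ∀ {x g₁ g₂ e} → Deg2 T (full T) x → g₁ ≢ g₂ →
                       Incident x g₁ → Incident x g₂ → Incident x e → e ≡ g₁ ⊎ e ≡ g₂
  Deg2⇒incident-pair {g₁ = g₁} {g₂} {e} (_ , _ , _ , _ , _ , only) g₁≢g₂ x-g₁ x-g₂ x-e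
    with only g₁ (tt , x-g₁) | only g₂ (tt , x-g₂) | only e (tt , x-e)
  ... | inj₁ refl | inj₁ refl | _        = ⊥-elim (g₁≢g₂ refl)
  ... | inj₂ refl | inj₂ refl | _        = ⊥-elim (g₁≢g₂ refl)
  ... | inj₁ refl | inj₂ refl | e≡g₁∨g₂ = e≡g₁∨g₂
  ... | inj₂ refl | inj₁ refl | e≡g₂∨g₁ = Sum.swap e≡g₂∨g₁

  Special∩hull⇒incident⊆hull : ∀ {x} → Sub.KV (hull T) x → (∃[ g ] Sub.KE (hull T) g × Incident x g) →
                               Special T (full T) x → ∀ e → Incident x e → Sub.KE (hull T) e
  Special∩hull⇒incident⊆hull _ (g , g∈hull , x-g) (inj₁ (_ , _ , _ , _ , only)) e x-e =
    subst (Sub.KE (hull T)) (trans (only g (tt , x-g)) (sym (only e (tt , x-e)))) g∈hull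
  Special∩hull⇒incident⊆hull (inj₁ x∈S) _ (inj₂ (inj₁ (_ , x∉S))) = ⊥-elim (Boolₚ.not-¬ x∈S x∉S)
  Special∩hull⇒incident⊆hull (inj₂ (a , b , q , simple , a∈S , b∈S , x∈q)) _ (inj₂ (inj₁ (deg2 , x∉S))) e x-e =
    let g₁ , g₂ , g₁≢g₂ , g₁∈q , g₂∈q , x-g₁ , x-g₂ = S-path-interior-pair q simple a∈S b∈S x∉S x∈q
    in Sum.[ (λ { refl → on-q g₁∈q }) , (λ { refl → on-q g₂∈q }) ]
         (Deg2⇒incident-pair deg2 g₁≢g₂ x-g₁ x-g₂ x-e)
    where
    on-q : ∀ {g} → g ∈ edges q → Sub.KE (hull T) g
    on-q g∈q = inj₂ (a , b , q , simple , a∈S , b∈S , g∈q)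
  Special∩hull⇒incident⊆hull _ _ (inj₂ (inj₂ (_ , _ , interior))) e x-e = inj₁ (interior e (tt , x-e))

  Special∩hull⇒Special-hull : ∀ {x} → Sub.KV (hull T) x → (∃[ g ] Sub.KE (hull T) g × Incident x g) →
                              Special T (full T) x → Special T (hull T) x
  Special∩hull⇒Special-hull x∈hull x-hull special =
    Special-restrict T {hull T} (Special∩hull⇒incident⊆hull x∈hull x-hull special) special

  hull-ParityA : ParityA T (full T) → ParityA T (hull T)
  hull-ParityA _ _ _ _ _ ([] , _ , _ , ())
  hull-ParityA parity u v u∈hull v∈hull (p@(f ∷⟨ s ⟩ r) , simple , p⊆hull , odd)
    with parity u v tt tt (p , simple , All.universal (λ _ → tt) _ , odd)
  ... | inj₁ u-special = inj₁ (Special∩hull⇒Special-hull u∈hull (f , All.head p⊆hull , Step⇒incidentˡ s) u-special)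
  ... | inj₂ v-special =
    let g , g∈p , v-g = last-edge s r
    in inj₂ (Special∩hull⇒Special-hull v∈hull (g , All.lookup p⊆hull g∈p , v-g) v-special)

proposition2p12 : (T : BYForest) →
    EquivIso T (full T) (hull T)
    × (∀ k → CardΦ T (full T) k ⇔ CardΦ T (hull T) k)
    × (ParityA T (full T) → ParityA T (hull T))
    × (ParityB T (full T) → ParityB T (hull T))
proposition2p12 T =
    sameCycles⇒EquivIso T hull-cycles⇔
  , sameCycles⇒CardΦ⇔ T hull-cycles⇔
  , hull-ParityA
  , λ parity k e _ → parity k e tt
  where open HullOfS T
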